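{- Every (finite) tree is a unit grid intersection graph.
   Context: A unit grid intersection graph is a bipartite graph $G$ with bipartition $(H,V)$ admitting an assignment of a horizontal closed line segment of length $1$ to each vertex of $H$ and a vertical closed line segment of length $1$ to each vertex of $V$, such that no two horizontal segments intersect, no two vertical segments intersect, and for $u\in H$, $v\in V$ the segments intersect if and only if $uv\in E(G)$. -}

module Defs where

open import Data.Nat using (ℕ; suc)
open import Data.Fin using (Fin; zero; suc; inject₁; fromℕ)
open import Data.Rational using (ℚ; _≤_; _+_; 1ℚ)
open import Data.Product using (Σ; ∃; _×_; proj₁; proj₂)
open import Relation.Binary.PropositionalEquality using (_≡_; _≢_)
open import Relation.Nullary using (¬_)
open import Function.Definitions using (Injective)
open import Function.Bundles using (_⇔_)

record Graph (n : ℕ) : Set₁ where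
  field
    Adj     : Fin n → Fin n → Set
    sym     : ∀ {u v} → Adj u v → Adj v u
    irrefl  : ∀ {u} → ¬ Adj u u
open Graph public

data Walk {n : ℕ} (G : Graph n) : Fin n → Fin n → Set where
  []  : ∀ {u} → Walk G u u
  _∷_ : ∀ {u w v} → Adj G u w → Walk G w v → Walk G u v

Connected : ∀ {n} → Graph n → Set
Connected G = ∀ u v → Walk G u v

-- A cycle of length k+3 : distinct vertices c 0, …, c (k+2), consecutive ones
-- adjacent, and the last adjacent to the first.
Cycle : ∀ {n} → Graph n → Set
Cycle {n} G =
  Σ ℕ λ k → Σ (Fin (suc (suc (suc k))) → Fin n) λ c →
    Injective _≡_ _≡_ c
    × (∀ (i : Fin (suc (suc k))) → Adj G (c (inject₁ i)) (c (suc i)))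
    × Adj G (c (fromℕ (suc (suc k)))) (c zero)

Acyclic : ∀ {n} → Graph n → Set
Acyclic G = ¬ Cycle G

IsTree : ∀ {n} → Graph n → Set
IsTree G = Connected G × Acyclic G

Point : Set
Point = ℚ × ℚ

data Orientation : Set where
  horizontal vertical : Orientation

InSegment : Orientation → Point → Point → Set
InSegment horizontal q p =
  proj₂ p ≡ proj₂ q × proj₁ q ≤ proj₁ p × proj₁ p ≤ proj₁ q + 1ℚ
InSegment vertical q p =
  proj₁ p ≡ proj₁ q × proj₂ q ≤ proj₂ p × proj₂ p ≤ proj₂ q + 1ℚ

SegmentsIntersect : Orientation → Point → Orientation → Point → Set
SegmentsIntersect o q o' q' = ∃ λ p → InSegment o q p × InSegment o' q' p

IsUGIG : ∀ {n} → Graph n → Set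
IsUGIG {n} G =
  Σ (Fin n → Orientation) λ side → Σ (Fin n → Point) λ pos →
    (∀ u v → Adj G u v → side u ≢ side v)
    × (∀ u v → u ≢ v → side u ≡ side v →
         ¬ SegmentsIntersect (side u) (pos u) (side v) (pos v))
    × (∀ u v → side u ≡ horizontal → side v ≡ vertical →
         (SegmentsIntersect (side u) (pos u) (side v) (pos v) ⇔ Adj G u v))

-- Root the tree and let each vertex v sit on level e = h ∸ depth v, h the height, so that a parent
-- is one level above its children. Even levels are horizontal, odd ones vertical, and level e
-- occupies the unit cell (⌈ e /2⌉ , ⌊ e /2⌋): consecutive cells form a staircase, so a horizontal
-- segment can only meet vertical segments of the two neighbouring levels, and it does so according
-- to how the fractional offsets (α , β) of the two vertices compare. The offset α v reads the
-- indices of the ancestors of v as the digits of a base-(n+1) expansion, β uses the complementary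
-- digits n ∸ i, so α + β depends on the depth only. Hence vertices of equal depth occupy disjoint
-- α-windows nested in those of their parents, and a vertex one level below x dominates x in both
-- offsets exactly when x is its parent, which is exactly when the two segments cross. Every tree
-- admits such a rooting because the simple path to the root is unique: two would close a cycle.
module Submission where

open import Defs hiding (sym)
open import Data.Empty using (⊥-elim)
open import Data.Fin as Fin using (Fin; toℕ; inject₁; fromℕ)
import Data.Fin.Properties as Fin
import Data.Integer as ℤ
import Data.Integer.Properties as ℤ
open import Data.Nat using (ℕ; zero; suc; _+_; _*_; _∸_; _^_; _⊔_; _≤_; _<_; z≤n; s≤s; ⌊_/2⌋; ⌈_/2⌉)
open import Data.Nat.Properties
open import Data.Nat.Tactic.RingSolver using (solve-∀)
open import Data.Product using (Σ; _×_; _,_; proj₁; proj₂)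
open import Data.Product.Function.NonDependent.Propositional using (_×-⇔_)
import Data.Rational as ℚ
import Data.Rational.Properties as ℚ
open import Data.Rational.Unnormalised using (ℚᵘ; mkℚᵘ; *≤*; *≡*)
import Data.Rational.Unnormalised as ℚᵘ
import Data.Rational.Unnormalised.Properties as ℚᵘ
open import Data.Sum using (_⊎_; inj₁; inj₂)
open import Data.Unit using (⊤; tt)
open import Function using (id; _∘_)
open import Function.Bundles using (_⇔_; mk⇔)
import Function.Properties.Equivalence as ⇔
open import Relation.Binary.Definitions using (tri<; tri≈; tri>)
open import Relation.Binary.PropositionalEquality
open import Relation.Nullary using (¬_; Dec; yes; no)
open import Relation.Nullary.Decidable using (_⊎-dec_)

-- A natural number x stands for the rational x / (1 + m), so the unit length is 1 + m.
module Scaled (m : ℕ) where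
  open import Data.Integer using (+_)

  scaleᵘ : ℕ → ℚᵘ
  scaleᵘ x = mkℚᵘ (+ x) m

  scale : ℕ → ℚ.ℚ
  scale x = ℚ.fromℚᵘ (scaleᵘ x)

  scaleᵘ-mono-≤ : ∀ {x y} → x ≤ y → scaleᵘ x ℚᵘ.≤ scaleᵘ y
  scaleᵘ-mono-≤ {x} {y} x≤y = *≤* (subst₂ ℤ._≤_ (ℤ.pos-* x (suc m)) (ℤ.pos-* y (suc m))
                                    (ℤ.+≤+ (*-monoˡ-≤ (suc m) x≤y)))

  scaleᵘ-cancel-≤ : ∀ {x y} → scaleᵘ x ℚᵘ.≤ scaleᵘ y → x ≤ y
  scaleᵘ-cancel-≤ {x} {y} (*≤* le) = *-cancelʳ-≤ x y (suc m)
    (ℤ.drop‿+≤+ (subst₂ ℤ._≤_ (sym (ℤ.pos-* x (suc m))) (sym (ℤ.pos-* y (suc m))) le))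

  scale-mono-≤ : ∀ {x y} → x ≤ y → scale x ℚ.≤ scale y
  scale-mono-≤ {x} {y} x≤y = ℚ.toℚᵘ-cancel-≤
    (ℚᵘ.≤-respʳ-≃ (ℚᵘ.≃-sym (ℚ.toℚᵘ-fromℚᵘ (scaleᵘ y)))
      (ℚᵘ.≤-respˡ-≃ (ℚᵘ.≃-sym (ℚ.toℚᵘ-fromℚᵘ (scaleᵘ x))) (scaleᵘ-mono-≤ x≤y)))

  scale-cancel-≤ : ∀ {x y} → scale x ℚ.≤ scale y → x ≤ y
  scale-cancel-≤ {x} {y} le = scaleᵘ-cancel-≤
    (ℚᵘ.≤-respʳ-≃ (ℚ.toℚᵘ-fromℚᵘ (scaleᵘ y))
      (ℚᵘ.≤-respˡ-≃ (ℚ.toℚᵘ-fromℚᵘ (scaleᵘ x)) (ℚ.toℚᵘ-mono-≤ le)))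

  scale-injective : ∀ {x y} → scale x ≡ scale y → x ≡ y
  scale-injective eq =
    ≤-antisym (scale-cancel-≤ (ℚ.≤-reflexive eq)) (scale-cancel-≤ (ℚ.≤-reflexive (sym eq)))

  scale-+1 : ∀ x → scale x ℚ.+ ℚ.1ℚ ≡ scale (x + suc m)
  scale-+1 x = ℚ.toℚᵘ-injective (begin-equality
    ℚ.toℚᵘ (scale x ℚ.+ ℚ.1ℚ)             ≃⟨ ℚ.toℚᵘ-homo-+ (scale x) ℚ.1ℚ ⟩
    ℚ.toℚᵘ (scale x) ℚᵘ.+ mkℚᵘ (+ 1) 0   ≃⟨ ℚᵘ.+-congˡ (mkℚᵘ (+ 1) 0) (ℚ.toℚᵘ-fromℚᵘ (scaleᵘ x)) ⟩
    scaleᵘ x ℚᵘ.+ mkℚᵘ (+ 1) 0           ≃⟨ scaleᵘ-+1 ⟩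
    scaleᵘ (x + suc m)                    ≃⟨ ℚ.toℚᵘ-fromℚᵘ (scaleᵘ (x + suc m)) ⟨
    ℚ.toℚᵘ (scale (x + suc m))            ∎)
    where
    open ℚᵘ.≤-Reasoning
    scaleᵘ-+1 : scaleᵘ x ℚᵘ.+ mkℚᵘ (+ 1) 0 ℚᵘ.≃ scaleᵘ (x + suc m)
    scaleᵘ-+1 = *≡* (cong₂ ℤ._*_ (cong₂ ℤ._+_ (ℤ.*-identityʳ (+ x)) (ℤ.*-identityˡ (+ suc m)))
                                 (cong +_ (sym (*-identityʳ (suc m)))))

  point : ℕ → ℕ → Point
  point x y = scale x , scale y

  crossing⇔ : ∀ {x y x' y'} →
    SegmentsIntersect horizontal (point x y) vertical (point x' y') ⇔
    ((x ≤ x' × x' ≤ x + suc m) × (y' ≤ y × y ≤ y' + suc m))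
  crossing⇔ {x} {y} {x'} {y'} = mk⇔ to from
    where
    to : SegmentsIntersect horizontal (point x y) vertical (point x' y') →
         (x ≤ x' × x' ≤ x + suc m) × (y' ≤ y × y ≤ y' + suc m)
    to (_ , (p₂≡y , x≤p₁ , p₁≤x+1) , (p₁≡x' , y'≤p₂ , p₂≤y'+1)) =
        (scale-cancel-≤ (subst (scale x ℚ.≤_) p₁≡x' x≤p₁)
      , scale-cancel-≤ (subst₂ ℚ._≤_ p₁≡x' (scale-+1 x) p₁≤x+1))
      , (scale-cancel-≤ (subst (scale y' ℚ.≤_) p₂≡y y'≤p₂)
      , scale-cancel-≤ (subst₂ ℚ._≤_ p₂≡y (scale-+1 y') p₂≤y'+1))
    from : (x ≤ x' × x' ≤ x + suc m) × (y' ≤ y × y ≤ y' + suc m) →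
           SegmentsIntersect horizontal (point x y) vertical (point x' y')
    from ((x≤x' , x'≤x+M) , (y'≤y , y≤y'+M)) = point x' y
      , (refl , scale-mono-≤ x≤x' , subst (scale x' ℚ.≤_) (sym (scale-+1 x)) (scale-mono-≤ x'≤x+M))
      , (refl , scale-mono-≤ y'≤y , subst (scale y ℚ.≤_) (sym (scale-+1 y')) (scale-mono-≤ y≤y'+M))

  horizontals-meet⇒same-row : ∀ {x y x' y'} →
    SegmentsIntersect horizontal (point x y) horizontal (point x' y') → y ≡ y'
  horizontals-meet⇒same-row (_ , (p₂≡y , _) , (p₂≡y' , _)) = scale-injective (trans (sym p₂≡y) p₂≡y')

  verticals-meet⇒same-column : ∀ {x y x' y'} →
    SegmentsIntersect vertical (point x y) vertical (point x' y') → x ≡ x'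
  verticals-meet⇒same-column (_ , (p₁≡x , _) , (p₁≡x' , _)) = scale-injective (trans (sym p₁≡x) p₁≡x')

[m*n+o]+n≡[1+m]*n+o : ∀ q M r → q * M + r + M ≡ suc q * M + r
[m*n+o]+n≡[1+m]*n+o = solve-∀

lex-≤ : ∀ {M} q q' {r r'} → q * M + r ≤ q' * M + r' → r' < M → q ≤ q'
lex-≤ {M} q q' {r} {r'} le r'<M with q ≤? q'
... | yes q≤q' = q≤q'
... | no q≰q' = ⊥-elim (<-irrefl refl (≤-<-trans le (begin-strict
  q' * M + r'  <⟨ +-monoʳ-< (q' * M) r'<M ⟩
  q' * M + M   ≡⟨ +-comm (q' * M) M ⟩
  suc q' * M   ≤⟨ *-monoˡ-≤ M (≰⇒> q≰q') ⟩
  q * M        ≤⟨ m≤m+n (q * M) r ⟩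
  q * M + r    ∎)))
  where open ≤-Reasoning

lex-injective : ∀ {M} q q' {r r'} → q * M + r ≡ q' * M + r' → r < M → r' < M → q ≡ q' × r ≡ r'
lex-injective {M} q q' {r} {r'} eq r<M r'<M =
  q≡q' , +-cancelˡ-≡ (q * M) r r' (trans eq (cong (λ k → k * M + r') (sym q≡q')))
  where
  q≡q' : q ≡ q'
  q≡q' = ≤-antisym (lex-≤ q q' (≤-reflexive eq) r'<M) (lex-≤ q' q (≤-reflexive (sym eq)) r<M)

lex-window : ∀ {M} q q' {r r'} → r < M → r' < M →
  (q * M + r ≤ q' * M + r' × q' * M + r' ≤ q * M + r + M) ⇔ ((q' ≡ q × r ≤ r') ⊎ (q' ≡ suc q × r' ≤ r))
lex-window {M} q q' {r} {r'} r<M r'<M = mk⇔ to from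
  where
  open ≤-Reasoning
  to : q * M + r ≤ q' * M + r' × q' * M + r' ≤ q * M + r + M → (q' ≡ q × r ≤ r') ⊎ (q' ≡ suc q × r' ≤ r)
  carry : q' * M + r' ≤ q * M + r + M → q' * M + r' ≤ suc q * M + r
  carry = subst (q' * M + r' ≤_) ([m*n+o]+n≡[1+m]*n+o q M r)
  to (lower , upper) with m≤n⇒m<n∨m≡n (lex-≤ q' (suc q) (carry upper) r<M)
  ... | inj₁ q'<1+q = inj₁ (q'≡q , +-cancelˡ-≤ (q * M) r r' (subst (λ k → q * M + r ≤ k * M + r') q'≡q lower))
    where q'≡q = ≤-antisym (≤-pred q'<1+q) (lex-≤ q q' lower r'<M)
  ... | inj₂ refl = inj₂ (refl , +-cancelˡ-≤ (suc q * M) r' r (carry upper))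
  from : (q' ≡ q × r ≤ r') ⊎ (q' ≡ suc q × r' ≤ r) → q * M + r ≤ q' * M + r' × q' * M + r' ≤ q * M + r + M
  from (inj₁ (refl , r≤r')) = +-monoʳ-≤ (q * M) r≤r' , (begin
    q * M + r'      ≤⟨ +-monoʳ-≤ (q * M) (<⇒≤ r'<M) ⟩
    q * M + M       ≤⟨ +-monoˡ-≤ M (m≤m+n (q * M) r) ⟩
    q * M + r + M   ∎)
  from (inj₂ (refl , r'≤r)) = (begin
    q * M + r       ≤⟨ +-monoʳ-≤ (q * M) (<⇒≤ r<M) ⟩
    q * M + M       ≡⟨ +-comm (q * M) M ⟩
    suc q * M       ≤⟨ m≤m+n (suc q * M) r' ⟩
    suc q * M + r'  ∎) , (begin
    suc q * M + r'  ≤⟨ +-monoʳ-≤ (suc q * M) r'≤r ⟩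
    suc q * M + r   ≡⟨ [m*n+o]+n≡[1+m]*n+o q M r ⟨
    q * M + r + M   ∎)

digit-gap : ∀ P {c c'} W → c < c' → P + c * W + W ≤ P + c' * W
digit-gap P {c} {c'} W c<c' = begin
  P + c * W + W  ≡⟨ reassociate P c W ⟩
  P + suc c * W  ≤⟨ +-monoʳ-≤ P (*-monoˡ-≤ W c<c') ⟩
  P + c' * W     ∎
  where
  open ≤-Reasoning
  reassociate : ∀ P c W → P + c * W + W ≡ P + suc c * W
  reassociate = solve-∀

gap-transfer : ∀ {a b a' b' w} → a + b ≡ a' + b' → a + w ≤ a' → b' + w ≤ b
gap-transfer {a} {b} {a'} {b'} {w} sum≡ a+w≤a' = +-cancelˡ-≤ a (b' + w) b (begin
  a + (b' + w)  ≡⟨ exchange a b' w ⟩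
  a + w + b'    ≤⟨ +-monoˡ-≤ b' a+w≤a' ⟩
  a' + b'       ≡⟨ sum≡ ⟨
  a + b         ∎)
  where
  open ≤-Reasoning
  exchange : ∀ a b' w → a + (b' + w) ≡ a + w + b'
  exchange = solve-∀

m∸n≡1+[m∸o]⇒o≡1+n : ∀ {m n o} → n ≤ m → o ≤ m → m ∸ n ≡ suc (m ∸ o) → o ≡ suc n
m∸n≡1+[m∸o]⇒o≡1+n {m} {n} {o} n≤m o≤m eq = +-cancelˡ-≡ (m ∸ o) o (suc n) (begin
  (m ∸ o) + o        ≡⟨ m∸n+n≡m o≤m ⟩
  m                  ≡⟨ m∸n+n≡m n≤m ⟨
  (m ∸ n) + n        ≡⟨ cong (_+ n) eq ⟩
  suc (m ∸ o) + n    ≡⟨ +-suc (m ∸ o) n ⟨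
  (m ∸ o) + suc n    ∎)
  where open ≡-Reasoning

maxᶠ : ∀ {m} → (Fin m → ℕ) → ℕ
maxᶠ {zero}  f = 0
maxᶠ {suc m} f = f Fin.zero ⊔ maxᶠ (f ∘ Fin.suc)

≤maxᶠ : ∀ {m} (f : Fin m → ℕ) i → f i ≤ maxᶠ f
≤maxᶠ f Fin.zero    = m≤m⊔n (f Fin.zero) _
≤maxᶠ f (Fin.suc i) = ≤-trans (≤maxᶠ (f ∘ Fin.suc) i) (m≤n⊔m (f Fin.zero) _)

orientation : ℕ → Orientation
orientation zero          = horizontal
orientation (suc zero)    = vertical
orientation (suc (suc e)) = orientation e

orientation-suc : ∀ e → orientation (suc e) ≢ orientation e
orientation-suc zero          ()
orientation-suc (suc zero)    ()
orientation-suc (suc (suc e)) = orientation-suc e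

⌈/2⌉-horizontal : ∀ e → orientation e ≡ horizontal → ⌈ e /2⌉ ≡ ⌊ e /2⌋
⌈/2⌉-horizontal zero          _ = refl
⌈/2⌉-horizontal (suc zero)    ()
⌈/2⌉-horizontal (suc (suc e)) h = cong suc (⌈/2⌉-horizontal e h)

⌈/2⌉-vertical : ∀ e → orientation e ≡ vertical → ⌈ e /2⌉ ≡ suc ⌊ e /2⌋
⌈/2⌉-vertical zero          ()
⌈/2⌉-vertical (suc zero)    _ = refl
⌈/2⌉-vertical (suc (suc e)) v = cong suc (⌈/2⌉-vertical e v)

halves-injective : ∀ {e e'} → ⌊ e /2⌋ ≡ ⌊ e' /2⌋ → ⌈ e /2⌉ ≡ ⌈ e' /2⌉ → e ≡ e'
halves-injective {e} {e'} ⌊⌋≡ ⌈⌉≡ =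
  trans (sym (⌊n/2⌋+⌈n/2⌉≡n e)) (trans (cong₂ _+_ ⌊⌋≡ ⌈⌉≡) (⌊n/2⌋+⌈n/2⌉≡n e'))

module Walks {n : ℕ} (G : Graph n) where

  length : ∀ {u v} → Walk G u v → ℕ
  length []      = 0
  length (_ ∷ w) = suc (length w)

  next : ∀ {u v} → Walk G u v → Fin n
  next ([] {u})          = u
  next (_∷_ {w = w} _ _) = w

  infix 4 _∈ᵥ_ _⊆ᵥ_

  _∈ᵥ_ : ∀ {u v} → Fin n → Walk G u v → Set
  x ∈ᵥ [] {u}          = x ≡ u
  x ∈ᵥ _∷_ {u = u} _ w = x ≡ u ⊎ x ∈ᵥ w

  _⊆ᵥ_ : ∀ {u v u' v'} → Walk G u v → Walk G u' v' → Set
  w ⊆ᵥ w' = ∀ {x} → x ∈ᵥ w → x ∈ᵥ w'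

  Simple : ∀ {u v} → Walk G u v → Set
  Simple []                = ⊤
  Simple (_∷_ {u = u} _ w) = ¬ u ∈ᵥ w × Simple w

  _∈ᵥ?_ : ∀ {u v} x (w : Walk G u v) → Dec (x ∈ᵥ w)
  x ∈ᵥ? []                = x Fin.≟ _
  x ∈ᵥ? (_∷_ {u = u} _ w) = (x Fin.≟ u) ⊎-dec (x ∈ᵥ? w)

  start-∈ᵥ : ∀ {u v} (w : Walk G u v) → u ∈ᵥ w
  start-∈ᵥ []      = refl
  start-∈ᵥ (_ ∷ _) = inj₁ refl

  end-∈ᵥ : ∀ {u v} (w : Walk G u v) → v ∈ᵥ w
  end-∈ᵥ []      = refl
  end-∈ᵥ (_ ∷ w) = inj₂ (end-∈ᵥ w)

  length≡0⇒≡ : ∀ {u v} (w : Walk G u v) → length w ≡ 0 → u ≡ v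
  length≡0⇒≡ [] _ = refl

  _++_ : ∀ {u v w} → Walk G u v → Walk G v w → Walk G u w
  []      ++ q = q
  (e ∷ p) ++ q = e ∷ (p ++ q)

  ∈ᵥ-++⁻ : ∀ {u v w x} (p : Walk G u v) (q : Walk G v w) → x ∈ᵥ p ++ q → x ∈ᵥ p ⊎ x ∈ᵥ q
  ∈ᵥ-++⁻ []      q x∈q          = inj₂ x∈q
  ∈ᵥ-++⁻ (e ∷ p) q (inj₁ x≡u)   = inj₁ (inj₁ x≡u)
  ∈ᵥ-++⁻ (e ∷ p) q (inj₂ x∈p++q) with ∈ᵥ-++⁻ p q x∈p++q
  ... | inj₁ x∈p = inj₁ (inj₂ x∈p)
  ... | inj₂ x∈q = inj₂ x∈q

  reverse : ∀ {u v} → Walk G u v → Walk G v u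
  reverse []      = []
  reverse (e ∷ w) = reverse w ++ (Graph.sym G e ∷ [])

  reverse-⊆ᵥ : ∀ {u v} (w : Walk G u v) → reverse w ⊆ᵥ w
  reverse-⊆ᵥ []      x∈w = x∈w
  reverse-⊆ᵥ (e ∷ w) x∈rev with ∈ᵥ-++⁻ (reverse w) _ x∈rev
  ... | inj₁ x∈w'          = inj₂ (reverse-⊆ᵥ w x∈w')
  ... | inj₂ (inj₁ refl)   = inj₂ (start-∈ᵥ w)
  ... | inj₂ (inj₂ x≡u)    = inj₁ x≡u

  suffix : ∀ {u v x} (w : Walk G u v) → Simple w → x ∈ᵥ w →
           Σ (Walk G x v) λ s → Simple s × s ⊆ᵥ w × length s ≤ length w
  suffix []      _        refl       = [] , tt , id , ≤-refl
  suffix (e ∷ w) simple   (inj₁ refl) = e ∷ w , simple , id , ≤-refl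
  suffix (e ∷ w) (_ , simple) (inj₂ x∈w) with suffix w simple x∈w
  ... | s , simple-s , s⊆w , s≤w = s , simple-s , inj₂ ∘ s⊆w , m≤n⇒m≤1+n s≤w

  proper-suffix : ∀ {u v x} (w : Walk G u v) → Simple w → x ∈ᵥ w → x ≢ u →
                  Σ (Walk G x v) λ s → Simple s × length s < length w
  proper-suffix []      _            refl        x≢u = ⊥-elim (x≢u refl)
  proper-suffix (e ∷ w) _            (inj₁ x≡u)  x≢u = ⊥-elim (x≢u x≡u)
  proper-suffix (e ∷ w) (_ , simple) (inj₂ x∈w) _ with suffix w simple x∈w
  ... | s , simple-s , _ , s≤w = s , simple-s , s≤s s≤w

  erase-loops : ∀ {u v} (w : Walk G u v) → Σ (Walk G u v) λ s → Simple s × s ⊆ᵥ w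
  erase-loops [] = [] , tt , id
  erase-loops (_∷_ {u = u} e w) with erase-loops w
  ... | s , simple , s⊆w with u ∈ᵥ? s
  ...   | yes u∈s = let (s' , simple' , s'⊆s , _) = suffix s simple u∈s in s' , simple' , inj₂ ∘ s⊆w ∘ s'⊆s
  ...   | no  u∉s = e ∷ s , (u∉s , simple) , λ { (inj₁ x≡u) → inj₁ x≡u ; (inj₂ x∈s) → inj₂ (s⊆w x∈s) }

  vertex : ∀ {u v} (w : Walk G u v) → Fin (suc (length w)) → Fin n
  vertex {u} w       Fin.zero    = u
  vertex     (_ ∷ w) (Fin.suc i) = vertex w i

  vertex-∈ᵥ : ∀ {u v} (w : Walk G u v) i → vertex w i ∈ᵥ w
  vertex-∈ᵥ w       Fin.zero    = start-∈ᵥ w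
  vertex-∈ᵥ (_ ∷ w) (Fin.suc i) = inj₂ (vertex-∈ᵥ w i)

  vertex-injective : ∀ {u v} (w : Walk G u v) → Simple w → ∀ {i j} → vertex w i ≡ vertex w j → i ≡ j
  vertex-injective w       _            {Fin.zero}  {Fin.zero}  _  = refl
  vertex-injective (_ ∷ w) (u∉w , _)    {Fin.zero}  {Fin.suc j} eq = ⊥-elim (u∉w (subst (_∈ᵥ w) (sym eq) (vertex-∈ᵥ w j)))
  vertex-injective (_ ∷ w) (u∉w , _)    {Fin.suc i} {Fin.zero}  eq = ⊥-elim (u∉w (subst (_∈ᵥ w) eq (vertex-∈ᵥ w i)))
  vertex-injective (_ ∷ w) (_ , simple) {Fin.suc i} {Fin.suc j} eq = cong Fin.suc (vertex-injective w simple eq)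

  vertex-adjacent : ∀ {u v} (w : Walk G u v) (i : Fin (length w)) →
                    Adj G (vertex w (inject₁ i)) (vertex w (Fin.suc i))
  vertex-adjacent (e ∷ _) Fin.zero    = e
  vertex-adjacent (_ ∷ w) (Fin.suc i) = vertex-adjacent w i

  vertex-last : ∀ {u v} (w : Walk G u v) → vertex w (fromℕ (length w)) ≡ v
  vertex-last []      = refl
  vertex-last (_ ∷ w) = vertex-last w

  closed-simple-walk⇒cycle : ∀ {u v} (w : Walk G u v) → Simple w → 2 ≤ length w → Adj G v u → Cycle G
  closed-simple-walk⇒cycle w@(_ ∷ (_ ∷ p)) simple _ back =
    length p , vertex w , vertex-injective w simple , vertex-adjacent w ,
    subst (λ x → Adj G x _) (sym (vertex-last w)) back
  closed-simple-walk⇒cycle (_ ∷ []) _ (s≤s ()) _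

  forked-walks⇒cycle : ∀ {a x y b} → Adj G a x → Adj G a y → x ≢ y →
                       (p : Walk G x b) (q : Walk G y b) → ¬ a ∈ᵥ p → ¬ a ∈ᵥ q → Cycle G
  forked-walks⇒cycle {a} ax ay x≢y p q a∉p a∉q with erase-loops (p ++ reverse q)
  ... | [] , _ , _ = ⊥-elim (x≢y refl)
  ... | s@(_ ∷ _) , simple , s⊆p++q =
    closed-simple-walk⇒cycle (ax ∷ s) (a∉s , simple) (s≤s (s≤s z≤n)) (Graph.sym G ay)
    where
    a∉s : ¬ a ∈ᵥ s
    a∉s a∈s with ∈ᵥ-++⁻ p (reverse q) (s⊆p++q a∈s)
    ... | inj₁ a∈p = a∉p a∈p
    ... | inj₂ a∈q = a∉q (reverse-⊆ᵥ q a∈q)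

  simple-walks-agree : Acyclic G → ∀ {a b} (p q : Walk G a b) → Simple p → Simple q →
                       length p ≡ length q × next p ≡ next q
  simple-walks-agree acyclic []      []      _ _ = refl , refl
  simple-walks-agree acyclic []      (_ ∷ q) _ (a∉q , _) = ⊥-elim (a∉q (end-∈ᵥ q))
  simple-walks-agree acyclic (_ ∷ p) []      (a∉p , _) _ = ⊥-elim (a∉p (end-∈ᵥ p))
  simple-walks-agree acyclic (_∷_ {w = x} ax p) (_∷_ {w = y} ay q) (a∉p , simple-p) (a∉q , simple-q)
    with x Fin.≟ y
  ... | yes refl = cong suc (proj₁ (simple-walks-agree acyclic p q simple-p simple-q)) , refl
  ... | no  x≢y  = ⊥-elim (acyclic (forked-walks⇒cycle ax ay x≢y p q a∉p a∉q))

record Rooting {n : ℕ} (G : Graph n) : Set where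
  field
    parent       : Fin n → Fin n
    depth        : Fin n → ℕ
    roots-unique : ∀ {u v} → depth u ≡ 0 → depth v ≡ 0 → u ≡ v
    parent-step  : ∀ {v d} → depth v ≡ suc d → depth (parent v) ≡ d × Adj G (parent v) v
    edge⇒parent  : ∀ {u v} → Adj G u v →
                   (depth u ≡ suc (depth v) × parent u ≡ v) ⊎ (depth v ≡ suc (depth u) × parent v ≡ u)

module _ {n : ℕ} (G : Graph n) (connected : Connected G) (acyclic : Acyclic G) (root : Fin n) where
  open Walks G

  private
    path : ∀ v → Walk G v root
    path v = proj₁ (erase-loops (connected v root))

    path-simple : ∀ v → Simple (path v)
    path-simple v = proj₁ (proj₂ (erase-loops (connected v root)))

    depth : Fin n → ℕ
    depth v = length (path v)

    parent : Fin n → Fin n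
    parent v = next (path v)

    agrees-with-path : ∀ {v} (p : Walk G v root) → Simple p → length p ≡ depth v × next p ≡ parent v
    agrees-with-path {v} p simple = simple-walks-agree acyclic p (path v) simple (path-simple v)

    step-towards-root : ∀ {v d} (p : Walk G v root) → Simple p → length p ≡ suc d →
                 depth (next p) ≡ d × Adj G (next p) v
    step-towards-root (e ∷ p) (_ , simple) eq =
      trans (sym (proj₁ (agrees-with-path p simple))) (suc-injective eq) , Graph.sym G e

    edge-onto-path : ∀ {u v} → Adj G u v → ¬ u ∈ᵥ path v → depth u ≡ suc (depth v) × parent u ≡ v
    edge-onto-path {u} {v} uv u∉path with agrees-with-path (uv ∷ path v) (u∉path , path-simple v)
    ... | depth-eq , parent-eq = sym depth-eq , sym parent-eq

    on-path⇒shallower : ∀ {x v} → x ∈ᵥ path v → x ≢ v → depth x < depth v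
    on-path⇒shallower {x} {v} x∈path x≢v with proper-suffix (path v) (path-simple v) x∈path x≢v
    ... | s , simple , s<path = subst (_< depth v) (proj₁ (agrees-with-path s simple)) s<path

  rootedAt : Rooting G
  rootedAt = record
    { parent       = parent
    ; depth        = depth
    ; roots-unique = λ {u} {v} du dv → trans (length≡0⇒≡ (path u) du) (sym (length≡0⇒≡ (path v) dv))
    ; parent-step  = λ {v} → step-towards-root (path v) (path-simple v)
    ; edge⇒parent  = edge⇒parent
    }
    where
    edge⇒parent : ∀ {u v} → Adj G u v →
                  (depth u ≡ suc (depth v) × parent u ≡ v) ⊎ (depth v ≡ suc (depth u) × parent v ≡ u)
    edge⇒parent {u} {v} uv with u ∈ᵥ? path v | v ∈ᵥ? path u
    ... | no u∉path | _         = inj₁ (edge-onto-path uv u∉path)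
    ... | yes _     | no v∉path = inj₂ (edge-onto-path (Graph.sym G uv) v∉path)
    ... | yes u∈path | yes v∈path =
      ⊥-elim (<-asym (on-path⇒shallower u∈path u≢v) (on-path⇒shallower v∈path (u≢v ∘ sym)))
      where
      u≢v : u ≢ v
      u≢v refl = Graph.irrefl G uv

tree⇒rooting : ∀ {n} (G : Graph n) → IsTree G → Rooting G
tree⇒rooting {zero}  G _                     = record
  { parent       = λ ()
  ; depth        = λ ()
  ; roots-unique = λ { {()} }
  ; parent-step  = λ { {()} }
  ; edge⇒parent  = λ { {()} }
  }
tree⇒rooting {suc n} G (connected , acyclic) = rootedAt G connected acyclic Fin.zero

module Layout {n : ℕ} (G : Graph n) (R : Rooting G) where
  open Rooting R

  height : ℕ
  height = maxᶠ depth

  depth≤height : ∀ v → depth v ≤ height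
  depth≤height = ≤maxᶠ depth

  base : ℕ
  base = suc n

  weight : ℕ → ℕ
  weight d = base ^ (height ∸ d)

  weight-pos : ∀ d → 0 < weight d
  weight-pos d = m^n>0 base (height ∸ d)

  weight-step : ∀ {d} → suc d ≤ height → weight d ≡ base * weight (suc d)
  weight-step {d} d<height = cong (base ^_) (+-∸-assoc 1 d<height)

  M : ℕ
  M = suc (weight 0)

  offsetAt : (Fin n → ℕ) → ℕ → Fin n → ℕ
  offsetAt δ zero    v = 0
  offsetAt δ (suc k) v = offsetAt δ k (parent v) + δ v * weight (suc k)

  offset : (Fin n → ℕ) → Fin n → ℕ
  offset δ v = offsetAt δ (depth v) v

  offset-parent : ∀ δ {v d} → depth v ≡ suc d → offset δ v ≡ offset δ (parent v) + δ v * weight (suc d)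
  offset-parent δ {v} dv rewrite dv | proj₁ (parent-step dv) = refl

  offset-parent-≤ : ∀ δ {v d} → depth v ≡ suc d → offset δ (parent v) ≤ offset δ v
  offset-parent-≤ δ {v} dv = ≤-trans (m≤m+n _ _) (≤-reflexive (sym (offset-parent δ dv)))

  module Digits (δ : Fin n → ℕ) (δ≤n : ∀ v → δ v ≤ n) where

    child-window : ∀ {v d} → depth v ≡ suc d → offset δ v + weight (suc d) ≤ offset δ (parent v) + weight d
    child-window {v} {d} dv = begin
      offset δ v + weight (suc d)
        ≡⟨ cong (_+ weight (suc d)) (offset-parent δ dv) ⟩
      offset δ (parent v) + δ v * weight (suc d) + weight (suc d)
        ≤⟨ digit-gap _ (weight (suc d)) (s≤s (δ≤n v)) ⟩
      offset δ (parent v) + base * weight (suc d)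
        ≡⟨ cong (offset δ (parent v) +_) (weight-step d<height) ⟨
      offset δ (parent v) + weight d
        ∎
      where
      open ≤-Reasoning
      d<height : suc d ≤ height
      d<height = subst (_≤ height) dv (depth≤height v)

    window-in-root : ∀ k {v} → depth v ≡ k → offset δ v + weight k ≤ weight 0
    window-in-root zero    {v} dv rewrite dv = ≤-refl
    window-in-root (suc k) {v} dv =
      ≤-trans (child-window dv) (window-in-root k (proj₁ (parent-step dv)))

    offset<M : ∀ v → offset δ v < M
    offset<M v = s≤s (≤-trans (m≤m+n _ _) (window-in-root (depth v) refl))

  span : ℕ → ℕ
  span zero    = 0
  span (suc k) = span k + n * weight (suc k)

  offsetAt-complementary : ∀ {δ δ'} → (∀ v → δ v + δ' v ≡ n) →
                           ∀ k v → offsetAt δ k v + offsetAt δ' k v ≡ span k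
  offsetAt-complementary         sum≡n zero    v = refl
  offsetAt-complementary {δ} {δ'} sum≡n (suc k) v = begin
    offsetAt δ k (parent v) + δ v * weight (suc k) + (offsetAt δ' k (parent v) + δ' v * weight (suc k))
      ≡⟨ regroup (offsetAt δ k (parent v)) (offsetAt δ' k (parent v)) (δ v) (δ' v) (weight (suc k)) ⟩
    offsetAt δ k (parent v) + offsetAt δ' k (parent v) + (δ v + δ' v) * weight (suc k)
      ≡⟨ cong₂ (λ a c → a + c * weight (suc k)) (offsetAt-complementary sum≡n k (parent v)) (sum≡n v) ⟩
    span k + n * weight (suc k)
      ∎
    where
    open ≡-Reasoning
    regroup : ∀ a b c d w → a + c * w + (b + d * w) ≡ a + b + (c + d) * w
    regroup = solve-∀

  α β : Fin n → ℕ
  α = offset toℕ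
  β = offset (λ v → n ∸ toℕ v)

  open Digits toℕ (λ v → <⇒≤ (Fin.toℕ<n v))
    using () renaming (child-window to α-child-window; offset<M to α<M)
  open Digits (λ v → n ∸ toℕ v) (λ v → m∸n≤m n (toℕ v))
    using () renaming (child-window to β-child-window; offset<M to β<M)

  α+β : ∀ v → α v + β v ≡ span (depth v)
  α+β v = offsetAt-complementary (λ w → m+[n∸m]≡n (<⇒≤ (Fin.toℕ<n w))) (depth v) v

  sibling-gap : ∀ {d x y} → depth x ≡ suc d → depth y ≡ suc d → parent x ≡ parent y → toℕ x < toℕ y →
                α x + weight (suc d) ≤ α y
  sibling-gap {d} {x} {y} dx dy px≡py x<y = begin
    α x + weight (suc d)                                   ≡⟨ cong (_+ weight (suc d)) (offset-parent toℕ dx) ⟩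
    α (parent x) + toℕ x * weight (suc d) + weight (suc d) ≤⟨ digit-gap _ (weight (suc d)) x<y ⟩
    α (parent x) + toℕ y * weight (suc d)                  ≡⟨ cong (λ p → α p + toℕ y * weight (suc d)) px≡py ⟩
    α (parent y) + toℕ y * weight (suc d)                  ≡⟨ offset-parent toℕ dy ⟨
    α y                                                    ∎
    where open ≤-Reasoning

  cousin-gap : ∀ {d x y} → depth x ≡ suc d → depth y ≡ suc d → α (parent x) + weight d ≤ α (parent y) →
               α x + weight (suc d) ≤ α y
  cousin-gap dx dy parents-gap = ≤-trans (α-child-window dx) (≤-trans parents-gap (offset-parent-≤ toℕ dy))

  α-separated : ∀ d {x y} → depth x ≡ d → depth y ≡ d → x ≢ y → α x + weight d ≤ α y ⊎ α y + weight d ≤ α x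
  α-separated zero    dx dy x≢y = ⊥-elim (x≢y (roots-unique dx dy))
  α-separated (suc d) {x} {y} dx dy x≢y with parent x Fin.≟ parent y
  ... | yes px≡py with <-cmp (toℕ x) (toℕ y)
  ...   | tri< x<y _ _ = inj₁ (sibling-gap dx dy px≡py x<y)
  ...   | tri≈ _ x≡y _ = ⊥-elim (x≢y (Fin.toℕ-injective x≡y))
  ...   | tri> _ _ y<x = inj₂ (sibling-gap dy dx (sym px≡py) y<x)
  α-separated (suc d) {x} {y} dx dy x≢y | no px≢py
    with α-separated d (proj₁ (parent-step dx)) (proj₁ (parent-step dy)) px≢py
  ... | inj₁ gap = inj₁ (cousin-gap dx dy gap)
  ... | inj₂ gap = inj₂ (cousin-gap dy dx gap)

  gap⇒< : ∀ {a b} d → a + weight d ≤ b → a < b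
  gap⇒< {a} d gap = <-≤-trans (m<m+n a (weight-pos d)) gap

  α-injective : ∀ {x y} → depth x ≡ depth y → α x ≡ α y → x ≡ y
  α-injective {x} {y} dx≡dy αx≡αy with x Fin.≟ y
  ... | yes x≡y = x≡y
  ... | no  x≢y with α-separated (depth x) refl (sym dx≡dy) x≢y
  ...   | inj₁ gap = ⊥-elim (<-irrefl αx≡αy (gap⇒< (depth x) gap))
  ...   | inj₂ gap = ⊥-elim (<-irrefl (sym αx≡αy) (gap⇒< (depth x) gap))

  -- The windows of y lie in those of its parent p. If p ≢ x, the α-windows of p and x are
  -- disjoint, and when that of x comes first, the complementary β-windows come in the other order.
  parent-by-offsets : ∀ {x y} → depth y ≡ suc (depth x) → α x ≤ α y → β x ≤ β y → parent y ≡ x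
  parent-by-offsets {x} {y} dy αx≤αy βx≤βy with parent y Fin.≟ x
  ... | yes py≡x = py≡x
  ... | no  py≢x with α-separated (depth x) (proj₁ (parent-step dy)) refl py≢x
  ...   | inj₁ gap = ⊥-elim (<-irrefl refl (begin-strict
    α y                             <⟨ gap⇒< (suc (depth x)) (α-child-window dy) ⟩
    α (parent y) + weight (depth x) ≤⟨ gap ⟩
    α x                             ≤⟨ αx≤αy ⟩
    α y                             ∎))
    where open ≤-Reasoning
  ...   | inj₂ gap = ⊥-elim (<-irrefl refl (begin-strict
    β y                             <⟨ gap⇒< (suc (depth x)) (β-child-window dy) ⟩
    β (parent y) + weight (depth x) ≤⟨ gap-transfer same-span gap ⟩
    β x                             ≤⟨ βx≤βy ⟩
    β y                             ∎))
    where
    open ≤-Reasoning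
    same-span : α x + β x ≡ α (parent y) + β (parent y)
    same-span = trans (α+β x) (trans (cong span (sym (proj₁ (parent-step dy)))) (sym (α+β (parent y))))

  level : Fin n → ℕ
  level v = height ∸ depth v

  level-parent : ∀ {x y} → depth y ≡ suc (depth x) → level x ≡ suc (level y)
  level-parent {x} {y} dy =
    trans (+-∸-assoc 1 (subst (_≤ height) dy (depth≤height y))) (cong (λ d → suc (height ∸ d)) (sym dy))

  level-injective : ∀ {x y} → level x ≡ level y → depth x ≡ depth y
  level-injective {x} {y} = ∸-cancelˡ-≡ (depth≤height x) (depth≤height y)

  level-suc⇒parent-depth : ∀ {x y} → level x ≡ suc (level y) → depth y ≡ suc (depth x)
  level-suc⇒parent-depth {x} {y} = m∸n≡1+[m∸o]⇒o≡1+n (depth≤height x) (depth≤height y)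

  side : Fin n → Orientation
  side v = orientation (level v)

  open Scaled (weight 0)

  X Y : Fin n → ℕ
  X v = ⌈ level v /2⌉ * M + α v
  Y v = ⌊ level v /2⌋ * M + β v

  pos : Fin n → Point
  pos v = point (X v) (Y v)

  adjacent⇒sides-differ : ∀ u v → Adj G u v → side u ≢ side v
  adjacent⇒sides-differ u v uv with edge⇒parent uv
  ... | inj₁ (du , _) = λ same →
    orientation-suc (level u) (trans (cong orientation (sym (level-parent du))) (sym same))
  ... | inj₂ (dv , _) = λ same →
    orientation-suc (level v) (trans (cong orientation (sym (level-parent dv))) same)

  β-injective : ∀ {u v} → depth u ≡ depth v → β u ≡ β v → u ≡ v
  β-injective {u} {v} du≡dv βu≡βv = α-injective du≡dv (+-cancelʳ-≡ (β u) (α u) (α v) (begin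
    α u + β u         ≡⟨ α+β u ⟩
    span (depth u)    ≡⟨ cong span du≡dv ⟩
    span (depth v)    ≡⟨ α+β v ⟨
    α v + β v         ≡⟨ cong (α v +_) βu≡βv ⟨
    α v + β u         ∎))
    where open ≡-Reasoning

  same-row⇒≡ : ∀ {u v} → side u ≡ horizontal → side v ≡ horizontal → Y u ≡ Y v → u ≡ v
  same-row⇒≡ {u} {v} hu hv Yu≡Yv with lex-injective ⌊ level u /2⌋ ⌊ level v /2⌋ Yu≡Yv (β<M u) (β<M v)
  ... | rows≡ , βu≡βv = β-injective (level-injective (halves-injective rows≡ columns≡)) βu≡βv
    where
    columns≡ : ⌈ level u /2⌉ ≡ ⌈ level v /2⌉
    columns≡ = trans (⌈/2⌉-horizontal (level u) hu) (trans rows≡ (sym (⌈/2⌉-horizontal (level v) hv)))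

  same-column⇒≡ : ∀ {u v} → side u ≡ vertical → side v ≡ vertical → X u ≡ X v → u ≡ v
  same-column⇒≡ {u} {v} hu hv Xu≡Xv with lex-injective ⌈ level u /2⌉ ⌈ level v /2⌉ Xu≡Xv (α<M u) (α<M v)
  ... | columns≡ , αu≡αv = α-injective (level-injective (halves-injective rows≡ columns≡)) αu≡αv
    where
    rows≡ : ⌊ level u /2⌋ ≡ ⌊ level v /2⌋
    rows≡ = suc-injective (trans (sym (⌈/2⌉-vertical (level u) hu)) (trans columns≡ (⌈/2⌉-vertical (level v) hv)))

  same-side⇒disjoint : ∀ u v → u ≢ v → side u ≡ side v → ¬ SegmentsIntersect (side u) (pos u) (side v) (pos v)
  same-side⇒disjoint u v u≢v same with side u in hu | side v in hv
  same-side⇒disjoint u v u≢v _  | horizontal | horizontal =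
    u≢v ∘ same-row⇒≡ hu hv ∘ horizontals-meet⇒same-row {X u} {Y u} {X v} {Y v}
  same-side⇒disjoint u v u≢v _  | vertical   | vertical   =
    u≢v ∘ same-column⇒≡ hu hv ∘ verticals-meet⇒same-column {X u} {Y u} {X v} {Y v}
  same-side⇒disjoint u v u≢v () | horizontal | vertical
  same-side⇒disjoint u v u≢v () | vertical   | horizontal

  -- Here ⌊ suc e /2⌋ unfolds to ⌈ e /2⌉, and ⌈ suc e /2⌉ to suc ⌊ e /2⌋, by definition.
  module Crossing {u v} (hu : side u ≡ horizontal) (hv : side v ≡ vertical) where

    ⌈u⌉≡⌊u⌋ : ⌈ level u /2⌉ ≡ ⌊ level u /2⌋
    ⌈u⌉≡⌊u⌋ = ⌈/2⌉-horizontal (level u) hu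

    ⌈v⌉≡1+⌊v⌋ : ⌈ level v /2⌉ ≡ suc ⌊ level v /2⌋
    ⌈v⌉≡1+⌊v⌋ = ⌈/2⌉-vertical (level v) hv

    ColumnCase RowCase : Set
    ColumnCase = (⌈ level v /2⌉ ≡ ⌈ level u /2⌉ × α u ≤ α v) ⊎ (⌈ level v /2⌉ ≡ suc ⌈ level u /2⌉ × α v ≤ α u)
    RowCase    = (⌊ level u /2⌋ ≡ ⌊ level v /2⌋ × β v ≤ β u) ⊎ (⌊ level u /2⌋ ≡ suc ⌊ level v /2⌋ × β u ≤ β v)

    crossing⇔cases : SegmentsIntersect horizontal (pos u) vertical (pos v) ⇔ (ColumnCase × RowCase)
    crossing⇔cases = ⇔.trans crossing⇔
      (lex-window ⌈ level u /2⌉ ⌈ level v /2⌉ (α<M u) (α<M v)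
       ×-⇔ lex-window ⌊ level v /2⌋ ⌊ level u /2⌋ (β<M v) (β<M u))

    parent-edge : ∀ {x y} → depth y ≡ suc (depth x) → α x ≤ α y → β x ≤ β y → Adj G x y
    parent-edge dy αx≤αy βx≤βy =
      subst (λ p → Adj G p _) (parent-by-offsets dy αx≤αy βx≤βy) (proj₂ (parent-step dy))

    cases⇒adjacent : ColumnCase × RowCase → Adj G u v
    cases⇒adjacent (inj₁ (columns≡ , αu≤αv) , inj₂ (rows≡ , βu≤βv)) =
      parent-edge (level-suc⇒parent-depth lu≡1+lv) αu≤αv βu≤βv
      where
      lu≡1+lv : level u ≡ suc (level v)
      lu≡1+lv = halves-injective (trans rows≡ (sym ⌈v⌉≡1+⌊v⌋)) (trans (sym columns≡) ⌈v⌉≡1+⌊v⌋)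
    cases⇒adjacent (inj₂ (columns≡ , αv≤αu) , inj₁ (rows≡ , βv≤βu)) =
      Graph.sym G (parent-edge (level-suc⇒parent-depth lv≡1+lu) αv≤αu βv≤βu)
      where
      lv≡1+lu : level v ≡ suc (level u)
      lv≡1+lu = halves-injective (trans (sym rows≡) (sym ⌈u⌉≡⌊u⌋)) (trans columns≡ (cong suc ⌈u⌉≡⌊u⌋))
    cases⇒adjacent (inj₁ (columns≡ , _) , inj₁ (rows≡ , _)) = ⊥-elim (horizontal≢vertical
      (trans (sym hu) (trans (cong orientation (halves-injective rows≡ (sym columns≡))) hv)))
      where
      horizontal≢vertical : horizontal ≢ vertical
      horizontal≢vertical ()
    cases⇒adjacent (inj₂ (columns≡ , _) , inj₂ (rows≡ , _)) = ⊥-elim (1+n≢n (sym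
      (trans (sym ⌈v⌉≡1+⌊v⌋) (trans columns≡ (cong suc (trans ⌈u⌉≡⌊u⌋ rows≡))))))

    adjacent⇒cases : Adj G u v → ColumnCase × RowCase
    adjacent⇒cases uv with edge⇒parent uv
    ... | inj₁ (du , pu≡v) =
      inj₂ (trans (cong ⌈_/2⌉ lv≡1+lu) (cong suc (sym ⌈u⌉≡⌊u⌋)) ,
            subst (λ p → α p ≤ α u) pu≡v (offset-parent-≤ toℕ du)) ,
      inj₁ (trans (sym ⌈u⌉≡⌊u⌋) (sym (cong ⌊_/2⌋ lv≡1+lu)) ,
            subst (λ p → β p ≤ β u) pu≡v (offset-parent-≤ _ du))
      where
      lv≡1+lu : level v ≡ suc (level u)
      lv≡1+lu = level-parent du
    ... | inj₂ (dv , pv≡u) =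
      inj₁ (trans ⌈v⌉≡1+⌊v⌋ (sym (cong ⌈_/2⌉ lu≡1+lv)) ,
            subst (λ p → α p ≤ α v) pv≡u (offset-parent-≤ toℕ dv)) ,
      inj₂ (trans (cong ⌊_/2⌋ lu≡1+lv) ⌈v⌉≡1+⌊v⌋ ,
            subst (λ p → β p ≤ β v) pv≡u (offset-parent-≤ _ dv))
      where
      lu≡1+lv : level u ≡ suc (level v)
      lu≡1+lv = level-parent dv

    crossing⇔adjacent : SegmentsIntersect horizontal (pos u) vertical (pos v) ⇔ Adj G u v
    crossing⇔adjacent = ⇔.trans crossing⇔cases (mk⇔ cases⇒adjacent adjacent⇒cases)

  isUGIG : IsUGIG G
  isUGIG = side , pos , adjacent⇒sides-differ , same-side⇒disjoint , crossing⇔adjacent′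
    where
    crossing⇔adjacent′ : ∀ u v → side u ≡ horizontal → side v ≡ vertical →
                         SegmentsIntersect (side u) (pos u) (side v) (pos v) ⇔ Adj G u v
    crossing⇔adjacent′ u v hu hv rewrite hu | hv = Crossing.crossing⇔adjacent hu hv

proposition4 : ∀ (n : ℕ) (G : Graph n) → IsTree G → IsUGIG G
proposition4 n G tree = Layout.isUGIG G (tree⇒rooting G tree)
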